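{- Let $(\mathcal{H},\mathcal{V})$ be a 2-horizontal web with $h = |\mathcal{H}|$ and $v = |\mathcal{V}|$. Then the digraph formed by the union of the paths in $\mathcal{H}$ and $\mathcal{V}$ contains a haven of order $\min(h,v)$. In particular, it has directed treewidth at least $\min(h,v) - 1$.
   Context: A linkage is a set of pairwise vertex-disjoint directed paths. A web $(\mathcal{H},\mathcal{V})$ is a pair of linkages such that every path of $\mathcal{V}$ intersects every path of $\mathcal{H}$. It is a 2-horizontal web if: - every $H_i \in \mathcal{H}$ decomposes as $H_i = H_i^1 \cdot H_i^2$; - every $V_j \in \mathcal{V}$ decomposes as $V_j = V_j^1 \cdot V_j^2$; - $V_j^1 \cap H_i \subseteq H_i^2$ and $V_j^1 \cap H_i^2 \neq \emptyset$; - $V_j^2 \cap H_i \subseteq H_i^1 \cup H_i^2$ and $V_j^2 \cap H_i^1 \neq \emptyset$. A haven of order $w$ in a digraph $D$ is a function $\beta$ that assigns to every $Z \subseteq V(D)$ with $|Z| < w$ the vertex set of a strong component of $D - Z$, such that $Z' \subseteq Z$ implies $\beta(Z) \subseteq \beta(Z')$. By Johnson, Robertson, Seymour and Thomas, a digraph with a haven of order $w$ has directed treewidth at least $w - 1$. -}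

module Defs where

open import Level using (0ℓ)
open import Data.Nat using (ℕ; _<_; _⊓_)
open import Data.Fin using (Fin)
open import Data.Fin.Subset using (Subset; _∈_; _∉_; _⊆_; ∣_∣)
open import Data.List using (List; _∷_; _++_)
open import Data.List.Relation.Unary.Unique.Propositional using (Unique)
import Data.List.Membership.Propositional as L
open import Data.Product using (Σ; ∃; ∃-syntax; _×_; _,_)
open import Data.Sum using (_⊎_)
open import Relation.Binary.PropositionalEquality using (_≡_; _≢_)
open import Relation.Binary.Construct.Closure.ReflexiveTransitive using (Star)
open import Relation.Nullary using (¬_)

record Digraph (n : ℕ) : Set₁ where
  field
    Vert : Fin n → Set
    Edge : Fin n → Fin n → Set
open Digraph public

-- A directed path: a sequence of pairwise distinct vertices, listed in order;
-- its arcs are the consecutive pairs.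
IsPath : {n : ℕ} → List (Fin n) → Set
IsPath P = Unique P

Consecutive : {n : ℕ} → Fin n → Fin n → List (Fin n) → Set
Consecutive x y P = ∃[ as ] ∃[ bs ] (P ≡ as ++ (x ∷ y ∷ bs))

Intersect : {n : ℕ} → List (Fin n) → List (Fin n) → Set
Intersect P Q = ∃[ x ] (x L.∈ P × x L.∈ Q)

IsLinkage : {n k : ℕ} → (Fin k → List (Fin n)) → Set
IsLinkage {k = k} L =
  ((i : Fin k) → IsPath (L i)) ×
  ((i j : Fin k) → i ≢ j → ¬ Intersect (L i) (L j))

IsWeb : {n h v : ℕ} → (Fin h → List (Fin n)) → (Fin v → List (Fin n)) → Set
IsWeb {h = h} {v = v} H V =
  IsLinkage H × IsLinkage V × ((i : Fin h) (j : Fin v) → Intersect (V j) (H i))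

Is2HorizontalWeb : {n h v : ℕ} → (Fin h → List (Fin n)) → (Fin v → List (Fin n)) → Set
Is2HorizontalWeb {n} {h} {v} H V =
  IsWeb H V ×
  Σ (Fin h → List (Fin n)) λ H¹ → Σ (Fin h → List (Fin n)) λ H² →
  Σ (Fin v → List (Fin n)) λ V¹ → Σ (Fin v → List (Fin n)) λ V² →
    ((i : Fin h) → H i ≡ H¹ i ++ H² i) ×
    ((j : Fin v) → V j ≡ V¹ j ++ V² j) ×
    ((i : Fin h) (j : Fin v) →
        ((x : Fin n) → x L.∈ V¹ j → x L.∈ H i → x L.∈ H² i) ×
        Intersect (V¹ j) (H² i) ×
        ((x : Fin n) → x L.∈ V² j → x L.∈ H i → (x L.∈ H¹ i ⊎ x L.∈ H² i)) ×
        Intersect (V² j) (H¹ i))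

unionDigraph : {n h v : ℕ} → (Fin h → List (Fin n)) → (Fin v → List (Fin n)) → Digraph n
unionDigraph {h = h} {v = v} H V = record
  { Vert = λ x → (∃[ i ] (x L.∈ H i)) ⊎ (∃[ j ] (x L.∈ V j))
  ; Edge = λ x y → (∃[ i ] Consecutive x y (H i)) ⊎ (∃[ j ] Consecutive x y (V j))
  }

VertMinus : {n : ℕ} → Digraph n → Subset n → Fin n → Set
VertMinus D Z x = Vert D x × x ∉ Z

EdgeMinus : {n : ℕ} → Digraph n → Subset n → Fin n → Fin n → Set
EdgeMinus D Z x y = Edge D x y × VertMinus D Z x × VertMinus D Z y

Reach : {n : ℕ} → Digraph n → Subset n → Fin n → Fin n → Set
Reach D Z = Star (EdgeMinus D Z)

IsStrongComponent : {n : ℕ} → Digraph n → Subset n → Subset n → Set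
IsStrongComponent {n} D Z C =
  (∃[ x ] x ∈ C) ×
  ((x : Fin n) → x ∈ C → VertMinus D Z x) ×
  ((x y : Fin n) → x ∈ C → VertMinus D Z y →
     (y ∈ C → Reach D Z x y × Reach D Z y x) ×
     (Reach D Z x y × Reach D Z y x → y ∈ C))

Admissible : {n : ℕ} → Digraph n → ℕ → Subset n → Set
Admissible {n} D w Z = ((x : Fin n) → x ∈ Z → Vert D x) × ∣ Z ∣ < w

IsHaven : {n : ℕ} → Digraph n → ℕ → (Subset n → Subset n) → Set
IsHaven D w β =
  (∀ Z → Admissible D w Z → IsStrongComponent D Z (β Z)) ×
  (∀ Z Z' → Admissible D w Z → Admissible D w Z' → Z' ⊆ Z → β Z ⊆ β Z')

HasHaven : {n : ℕ} → Digraph n → ℕ → Set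
HasHaven D w = Σ (Subset _ → Subset _) λ β → IsHaven D w β

{-# OPTIONS --safe #-}
-- If |Z| < min(h, v), pigeonhole on the disjoint paths gives some H_i and some V_j missing Z.
-- Fix an anchor a_ij ∈ V¹_j ∩ H²_i for every pair.  If V_j and H_i′ miss Z, then D − Z has
-- a walk from a_ij along V_j to a vertex of V²_j ∩ H¹_i′ and on along H_i′ to a_i′j′ ∈ H²_i′.
-- Hence the anchors of all pairs missing Z are strongly connected in D − Z, and β(Z) is their
-- strong component.  Shrinking Z keeps these pairs and walks, which gives monotonicity.
-- Only the two nonemptiness conditions of a 2-horizontal web are used.  Since a Subset is a
-- bit vector, β(Z) has to be computed, so reachability in D − Z is decided by a closure search.
module Submission where

open import Defs
open import Data.Nat using (ℕ; _⊓_; suc; _+_; _≤_; _<_; z≤n)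
open import Data.Nat.Properties
  using (<-≤-trans; ≤-<-trans; ≤-trans; ≤-reflexive; +-suc; +-identityʳ; +-monoˡ-≤; n<1+n; ≤⇒≯; <⇒≱;
         m<n⊓o⇒m<n; m<n⊓o⇒m<o)
open import Data.Fin using (Fin; zero; suc)
open import Data.Fin.Properties using (_≟_; any?; all?; ¬∀⟶∃¬; suc-injective; 0≢1+n)
open import Data.Fin.Subset using (Subset; _∈_; _∉_; _⊆_; ∣_∣; _∪_; ⁅_⁆; _-_)
open import Data.Fin.Subset.Properties
  using (_∈?_; ∣p∣≤n; ∣⁅x⁆∣≡1; x∈⁅x⁆; x∈⁅y⁆⇒x≡y; p⊆p∪q; x∈p∪q⁺; x∈p∪q⁻; p⊂q⇒∣p∣<∣q∣;
         x∈p∧x≢y⇒x∈p-y; x∈p⇒∣p-x∣<∣p∣)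
open import Data.List using (List; []; _∷_; _++_)
open import Data.List.Properties using (∷-injective)
open import Data.List.Membership.Propositional using (find) renaming (_∈_ to _∈ₗ_)
open import Data.List.Membership.Propositional.Properties using (∈-++⁺ˡ; ∈-++⁺ʳ)
open import Data.List.Relation.Unary.Any using (Any; here; there)
import Data.List.Relation.Unary.Any as Any
open import Data.List.Relation.Unary.All using (All; []; _∷_)
import Data.List.Relation.Unary.All as All
open import Data.List.Relation.Unary.All.Properties.Core using (¬Any⇒All¬)
open import Data.List.Relation.Unary.Linked using (Linked; []; [-]; _∷_)
import Data.List.Relation.Unary.Linked as Linked
open import Data.Vec using (tabulate)
open import Data.Vec.Properties using (lookup∘tabulate; []=⇒lookup; lookup⇒[]=)
open import Data.Product using (∃-syntax; _×_; _,_; proj₁; proj₂)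
open import Data.Sum using (inj₁; inj₂)
open import Function using (_∘_)
open import Function.Definitions using (Injective)
open import Level using (Level)
open import Relation.Binary using (Rel)
open import Relation.Binary.Definitions using (Decidable)
open import Relation.Binary.PropositionalEquality using (_≡_; _≢_; refl; sym; trans; cong; subst)
open import Relation.Binary.Construct.Closure.ReflexiveTransitive using (Star; ε; _◅_; _◅◅_)
import Relation.Binary.Construct.Closure.ReflexiveTransitive as Star
open import Relation.Nullary using (¬_; Dec; yes; no; does; ¬?; contradiction)
open import Relation.Nullary.Decidable using (_×-dec_; _⊎-dec_; map′; dec-true; decidable-stable)
open import Relation.Unary using (Pred)
import Relation.Unary as U

private
  variable
    ℓ : Level
    n k : ℕ

decSubset : {P : Pred (Fin n) ℓ} → U.Decidable P → Subset n
decSubset P? = tabulate (does ∘ P?)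

module _ {P : Pred (Fin n) ℓ} (P? : U.Decidable P) where

  ∈decSubset⁺ : ∀ {y} → P y → y ∈ decSubset P?
  ∈decSubset⁺ {y} py = lookup⇒[]= y _ (trans (lookup∘tabulate (does ∘ P?) y) (dec-true (P? y) py))

  ∈decSubset⁻ : ∀ {y} → y ∈ decSubset P? → P y
  ∈decSubset⁻ {y} y∈ with P? y | trans (sym (lookup∘tabulate (does ∘ P?) y)) ([]=⇒lookup y∈)
  ... | yes py | _ = py
  ... | no _   | ()

injective⇒≤∣p∣ : {p : Subset n} (f : Fin k → Fin n) → Injective _≡_ _≡_ f → (∀ i → f i ∈ p) → k ≤ ∣ p ∣
injective⇒≤∣p∣ {k = 0} f f-inj f∈p = z≤n
injective⇒≤∣p∣ {k = suc k} {p = p} f f-inj f∈p =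
  ≤-<-trans (injective⇒≤∣p∣ (f ∘ suc) (suc-injective ∘ f-inj) f∘suc∈p-f0) (x∈p⇒∣p-x∣<∣p∣ (f∈p zero))
  where
    f∘suc∈p-f0 : ∀ i → f (suc i) ∈ p - f zero
    f∘suc∈p-f0 i = x∈p∧x≢y⇒x∈p-y (f∈p (suc i)) (0≢1+n ∘ sym ∘ f-inj)

module FiniteReachability {E : Rel (Fin n) ℓ} (E? : Decidable E) where

  Closed : Subset n → Set ℓ
  Closed S = ∀ {y z} → y ∈ S → E y z → z ∈ S

  closed-star : ∀ {S y z} → Closed S → y ∈ S → Star E y z → z ∈ S
  closed-star closed y∈S ε = y∈S
  closed-star closed y∈S (e ◅ st) = closed-star closed (closed y∈S e) st

  record ReachClosure (x : Fin n) : Set ℓ where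
    field
      carrier   : Subset n
      source    : x ∈ carrier
      reachable : ∀ {y} → y ∈ carrier → Star E x y
      closed    : Closed carrier

  -- Every step adds a vertex to S, so the bound n < ∣ S ∣ + k rules out running out of fuel.
  grow : ∀ {x} k (S : Subset n) → n < ∣ S ∣ + k → x ∈ S → (∀ {y} → y ∈ S → Star E x y) → ReachClosure x
  grow 0 S bound _ _ = contradiction (subst (n <_) (+-identityʳ ∣ S ∣) bound) (≤⇒≯ (∣p∣≤n S))
  grow {x} (suc k) S bound x∈S reach-S
    with any? (λ y → any? (λ z → (y ∈? S) ×-dec E? y z ×-dec ¬? (z ∈? S)))
  ... | yes (y , z , y∈S , e , z∉S) = grow k (S ∪ ⁅ z ⁆) bound′ (p⊆p∪q _ x∈S) reach-S∪z
    where
      ∣S∣<∣S∪z∣ : ∣ S ∣ < ∣ S ∪ ⁅ z ⁆ ∣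
      ∣S∣<∣S∪z∣ = p⊂q⇒∣p∣<∣q∣ (p⊆p∪q _ , z , x∈p∪q⁺ (inj₂ (x∈⁅x⁆ z)) , z∉S)
      bound′ : n < ∣ S ∪ ⁅ z ⁆ ∣ + k
      bound′ = <-≤-trans bound (≤-trans (≤-reflexive (+-suc ∣ S ∣ k)) (+-monoˡ-≤ k ∣S∣<∣S∪z∣))
      reach-S∪z : ∀ {w} → w ∈ S ∪ ⁅ z ⁆ → Star E x w
      reach-S∪z w∈ with x∈p∪q⁻ S ⁅ z ⁆ w∈
      ... | inj₁ w∈S = reach-S w∈S
      ... | inj₂ w∈z with x∈⁅y⁆⇒x≡y z w∈z
      ... | refl = reach-S y∈S ◅◅ (e ◅ ε)
  ... | no no-arc-leaves = record
    { carrier = S ; source = x∈S ; reachable = reach-S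
    ; closed = λ {y} {z} y∈S e → decidable-stable (z ∈? S) (λ z∉S → no-arc-leaves (y , z , y∈S , e , z∉S))
    }

  reachClosure : ∀ x → ReachClosure x
  reachClosure x = grow n ⁅ x ⁆ (subst (λ m → n < m + n) (sym (∣⁅x⁆∣≡1 x)) (n<1+n n)) (x∈⁅x⁆ x) reach-x
    where
      reach-x : ∀ {y} → y ∈ ⁅ x ⁆ → Star E x y
      reach-x y∈ with x∈⁅y⁆⇒x≡y x y∈
      ... | refl = ε

  star? : Decidable (Star E)
  star? x y = map′ reachable (closed-star closed source) (y ∈? carrier)
    where open ReachClosure (reachClosure x)

consecutive? : (x y : Fin n) (L : List (Fin n)) → Dec (Consecutive x y L)
consecutive? x y [] = no λ { ([] , _ , ()) ; (_ ∷ _ , _ , ()) }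
consecutive? x y (a ∷ []) = no λ { ([] , _ , ()) ; (_ ∷ [] , _ , ()) ; (_ ∷ _ ∷ _ , _ , ()) }
consecutive? x y (a ∷ b ∷ L) with (a ≟ x) ×-dec (b ≟ y) | consecutive? x y (b ∷ L)
... | yes (refl , refl) | _                 = yes ([] , L , refl)
... | no _              | yes (as , bs , eq) = yes (a ∷ as , bs , cong (a ∷_) eq)
... | no ¬first         | no ¬later         = no λ
  { ([] , _ , refl)     → ¬first (refl , refl)
  ; (_ ∷ as , bs , eq) → ¬later (as , bs , proj₂ (∷-injective eq))
  }

module _ {R : Rel (Fin n) ℓ} where

  consecutive⇒linked : ∀ L → (∀ {a b} → Consecutive a b L → R a b) → Linked R L
  consecutive⇒linked [] _ = []
  consecutive⇒linked (a ∷ []) _ = [-]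
  consecutive⇒linked (a ∷ b ∷ L) r =
    r ([] , L , refl) ∷ consecutive⇒linked (b ∷ L) (λ (as , bs , eq) → r (a ∷ as , bs , cong (a ∷_) eq))

  linked⇒star-head : ∀ {x y xs} → Linked R (x ∷ xs) → y ∈ₗ xs → Star R x y
  linked⇒star-head (r ∷ _) (here refl) = r ◅ ε
  linked⇒star-head (r ∷ l) (there y∈) = r ◅ linked⇒star-head l y∈

  linked-++⇒star : ∀ {x y} xs {ys} → Linked R (xs ++ ys) → x ∈ₗ xs → y ∈ₗ ys → Star R x y
  linked-++⇒star (_ ∷ xs) l (here refl) y∈ = linked⇒star-head l (∈-++⁺ʳ xs y∈)
  linked-++⇒star (_ ∷ xs) l (there x∈) y∈ = linked-++⇒star xs (Linked.tail l) x∈ y∈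

Avoids : Subset n → List (Fin n) → Set
Avoids Z P = All (_∉ Z) P

avoids? : ∀ Z (P : List (Fin n)) → Dec (Avoids Z P)
avoids? Z = All.all? (λ x → ¬? (x ∈? Z))

avoids-antitone : ∀ {Z Z′ : Subset n} {P} → Z′ ⊆ Z → Avoids Z P → Avoids Z′ P
avoids-antitone Z′⊆Z = All.map (λ x∉Z x∈Z′ → x∉Z (Z′⊆Z x∈Z′))

meeting-disjoint⇒≤∣p∣ : (P : Fin k → List (Fin n)) → (∀ i j → i ≢ j → ¬ Intersect (P i) (P j)) →
                        ∀ {Z} → (∀ i → Any (_∈ Z) (P i)) → k ≤ ∣ Z ∣
meeting-disjoint⇒≤∣p∣ P disjoint meets = injective⇒≤∣p∣ hit hit-injective (proj₂ ∘ proj₂ ∘ find ∘ meets)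
  where
    hit = proj₁ ∘ find ∘ meets
    hit∈P : ∀ i → hit i ∈ₗ P i
    hit∈P = proj₁ ∘ proj₂ ∘ find ∘ meets
    hit-injective : Injective _≡_ _≡_ hit
    hit-injective {i} {j} eq with i ≟ j
    ... | yes i≡j = i≡j
    ... | no i≢j  = contradiction (hit i , hit∈P i , subst (_∈ₗ P j) (sym eq) (hit∈P j)) (disjoint i j i≢j)

some-path-avoids : (P : Fin k → List (Fin n)) → (∀ i j → i ≢ j → ¬ Intersect (P i) (P j)) →
             ∀ Z → ∣ Z ∣ < k → ∃[ i ] Avoids Z (P i)
some-path-avoids {k} P disjoint Z ∣Z∣<k = avoiding (all? meets?)
  where
    meets? : ∀ i → Dec (Any (_∈ Z) (P i))
    meets? i = Any.any? (_∈? Z) (P i)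
    avoiding : Dec (∀ i → Any (_∈ Z) (P i)) → ∃[ i ] Avoids Z (P i)
    avoiding (yes allMeet) = contradiction (meeting-disjoint⇒≤∣p∣ P disjoint allMeet) (<⇒≱ ∣Z∣<k)
    avoiding (no ¬allMeet) = let i , ¬meet = ¬∀⟶∃¬ k _ meets? ¬allMeet in i , ¬Any⇒All¬ (P i) ¬meet

module _ {D : Digraph n} where

  Mutual : Subset n → Fin n → Fin n → Set
  Mutual Z x y = Reach D Z x y × Reach D Z y x

  mutual-sym : ∀ {Z x y} → Mutual Z x y → Mutual Z y x
  mutual-sym (xy , yx) = yx , xy

  mutual-trans : ∀ {Z x y z} → Mutual Z x y → Mutual Z y z → Mutual Z x z
  mutual-trans (xy , yx) (yz , zy) = xy ◅◅ yz , zy ◅◅ yx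

  reach-antitone : ∀ {Z Z′} → Z′ ⊆ Z → ∀ {x y} → Reach D Z x y → Reach D Z′ x y
  reach-antitone Z′⊆Z = Star.map λ (e , (vx , x∉Z) , (vy , y∉Z)) → e , (vx , x∉Z ∘ Z′⊆Z) , (vy , y∉Z ∘ Z′⊆Z)

  reach⇒vertMinus : ∀ {Z x y} → Reach D Z x y → VertMinus D Z y → VertMinus D Z x
  reach⇒vertMinus ε vy = vy
  reach⇒vertMinus ((_ , vx , _) ◅ _) _ = vx

  linked-minus : ∀ {Z P} → Linked (Edge D) P → All (Vert D) P → Avoids Z P → Linked (EdgeMinus D Z) P
  linked-minus [] _ _ = []
  linked-minus [-] _ _ = [-]
  linked-minus (e ∷ l) (vx ∷ vys@(vy ∷ _)) (x∉Z ∷ ys∉Z@(y∉Z ∷ _)) =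
    (e , (vx , x∉Z) , (vy , y∉Z)) ∷ linked-minus l vys ys∉Z

  mutualClass⇒isStrongComponent : ∀ {Z C a} → VertMinus D Z a →
    (∀ {y} → y ∈ C → Mutual Z a y) → (∀ {y} → Mutual Z a y → y ∈ C) → IsStrongComponent D Z C
  mutualClass⇒isStrongComponent {a = a} va C⇒mutual mutual⇒C =
    (a , mutual⇒C (ε , ε)) ,
    (λ x x∈C → reach⇒vertMinus (proj₂ (C⇒mutual x∈C)) va) ,
    (λ x y x∈C _ → (λ y∈C → mutual-trans (mutual-sym (C⇒mutual x∈C)) (C⇒mutual y∈C)) ,
                   (λ xy → mutual⇒C (mutual-trans (C⇒mutual x∈C) xy)))

  module _ (vert? : U.Decidable (Vert D)) (edge? : Decidable (Edge D)) where

    reach? : ∀ Z → Decidable (Reach D Z)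
    reach? Z = FiniteReachability.star? edgeMinus?
      where
        vertMinus? : U.Decidable (VertMinus D Z)
        vertMinus? x = vert? x ×-dec ¬? (x ∈? Z)
        edgeMinus? : Decidable (EdgeMinus D Z)
        edgeMinus? x y = edge? x y ×-dec vertMinus? x ×-dec vertMinus? y

    mutual? : ∀ Z → Decidable (Mutual Z)
    mutual? Z x y = reach? Z x y ×-dec reach? Z y x

module WebHaven
  {h v : ℕ} (H : Fin h → List (Fin n)) (V : Fin v → List (Fin n))
  (H-disjoint : ∀ i i′ → i ≢ i′ → ¬ Intersect (H i) (H i′))
  (V-disjoint : ∀ j j′ → j ≢ j′ → ¬ Intersect (V j) (V j′))
  (H¹ H² : Fin h → List (Fin n)) (V¹ V² : Fin v → List (Fin n))
  (H-split : ∀ i → H i ≡ H¹ i ++ H² i) (V-split : ∀ j → V j ≡ V¹ j ++ V² j)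
  (V¹∩H² : ∀ i j → Intersect (V¹ j) (H² i))
  (V²∩H¹ : ∀ i j → Intersect (V² j) (H¹ i))
  where

  D : Digraph n
  D = unionDigraph H V

  vert? : U.Decidable (Vert D)
  vert? x = any? (λ i → Any.any? (x ≟_) (H i)) ⊎-dec any? (λ j → Any.any? (x ≟_) (V j))

  edge? : Decidable (Edge D)
  edge? x y = any? (λ i → consecutive? x y (H i)) ⊎-dec any? (λ j → consecutive? x y (V j))

  H-linked : ∀ {Z} i → Avoids Z (H i) → Linked (EdgeMinus D Z) (H¹ i ++ H² i)
  H-linked i H∉Z = subst (Linked _) (H-split i)
    (linked-minus (consecutive⇒linked (H i) (λ c → inj₁ (i , c))) (All.tabulate (λ x∈ → inj₁ (i , x∈))) H∉Z)

  V-linked : ∀ {Z} j → Avoids Z (V j) → Linked (EdgeMinus D Z) (V¹ j ++ V² j)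
  V-linked j V∉Z = subst (Linked _) (V-split j)
    (linked-minus (consecutive⇒linked (V j) (λ c → inj₂ (j , c))) (All.tabulate (λ x∈ → inj₂ (j , x∈))) V∉Z)

  anchor : Fin h → Fin v → Fin n
  anchor i j = proj₁ (V¹∩H² i j)

  anchor-vertMinus : ∀ {Z} i j → Avoids Z (V j) → VertMinus D Z (anchor i j)
  anchor-vertMinus i j V∉Z = inj₂ (j , anchor∈V) , All.lookup V∉Z anchor∈V
    where
      anchor∈V : anchor i j ∈ₗ V j
      anchor∈V = subst (anchor i j ∈ₗ_) (sym (V-split j)) (∈-++⁺ˡ (proj₁ (proj₂ (V¹∩H² i j))))

  anchor-reach : ∀ {Z} i j i′ j′ → Avoids Z (V j) → Avoids Z (H i′) → Reach D Z (anchor i j) (anchor i′ j′)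
  anchor-reach i j i′ j′ V∉Z H′∉Z =
    let (_ , _ , anchor∈H²) = V¹∩H² i′ j′
        (_ , anchor∈V¹ , _) = V¹∩H² i j
        (_ , y∈V² , y∈H¹)   = V²∩H¹ i′ j
    in linked-++⇒star (V¹ j) (V-linked j V∉Z) anchor∈V¹ y∈V²
       ◅◅ linked-++⇒star (H¹ i′) (H-linked i′ H′∉Z) y∈H¹ anchor∈H²

  Anchored : Subset n → Fin n → Set
  Anchored Z y = ∃[ i ] ∃[ j ] (Avoids Z (H i) × Avoids Z (V j)) × Mutual {D = D} Z (anchor i j) y

  anchored? : ∀ Z → U.Decidable (Anchored Z)
  anchored? Z y = any? λ i → any? λ j →
    (avoids? Z (H i) ×-dec avoids? Z (V j)) ×-dec mutual? vert? edge? Z (anchor i j) y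

  anchored⇒mutual : ∀ {Z i j y} → Avoids Z (H i) → Avoids Z (V j) → Anchored Z y → Mutual Z (anchor i j) y
  anchored⇒mutual {i = i} {j} H∉Z V∉Z (i′ , j′ , (H′∉Z , V′∉Z) , m) =
    mutual-trans (anchor-reach i j i′ j′ V∉Z H′∉Z , anchor-reach i′ j′ i j V′∉Z H∉Z) m

  anchored-antitone : ∀ {Z Z′ y} → Z′ ⊆ Z → Anchored Z y → Anchored Z′ y
  anchored-antitone Z′⊆Z (i , j , (H∉Z , V∉Z) , (xy , yx)) =
    i , j , (avoids-antitone Z′⊆Z H∉Z , avoids-antitone Z′⊆Z V∉Z) ,
    (reach-antitone Z′⊆Z xy , reach-antitone Z′⊆Z yx)

  β : Subset n → Subset n
  β Z = decSubset (anchored? Z)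

  β-isStrongComponent : ∀ Z → ∣ Z ∣ < h ⊓ v → IsStrongComponent D Z (β Z)
  β-isStrongComponent Z ∣Z∣<h⊓v =
    let (i , H∉Z) = some-path-avoids H H-disjoint Z (m<n⊓o⇒m<n h v ∣Z∣<h⊓v)
        (j , V∉Z) = some-path-avoids V V-disjoint Z (m<n⊓o⇒m<o h v ∣Z∣<h⊓v)
    in mutualClass⇒isStrongComponent (anchor-vertMinus i j V∉Z)
         (anchored⇒mutual H∉Z V∉Z ∘ ∈decSubset⁻ (anchored? Z))
         (λ m → ∈decSubset⁺ (anchored? Z) (i , j , (H∉Z , V∉Z) , m))

  β-antitone : ∀ {Z Z′} → Z′ ⊆ Z → β Z ⊆ β Z′
  β-antitone Z′⊆Z = ∈decSubset⁺ (anchored? _) ∘ anchored-antitone Z′⊆Z ∘ ∈decSubset⁻ (anchored? _)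

  haven : IsHaven D (h ⊓ v) β
  haven = (λ Z (_ , ∣Z∣<h⊓v) → β-isStrongComponent Z ∣Z∣<h⊓v) ,
          (λ _ _ _ _ Z′⊆Z → β-antitone Z′⊆Z)

mainTheorem12 : (n h v : ℕ) (H : Fin h → List (Fin n)) (V : Fin v → List (Fin n)) →
    Is2HorizontalWeb H V → HasHaven (unionDigraph H V) (h ⊓ v)
mainTheorem12 n h v H V (((_ , H-disjoint) , (_ , V-disjoint) , _) , H¹ , H² , V¹ , V² , H-split , V-split , meets) =
  β , haven
  where
    open WebHaven H V H-disjoint V-disjoint H¹ H² V¹ V² H-split V-split
      (λ i j → proj₁ (proj₂ (meets i j))) (λ i j → proj₂ (proj₂ (proj₂ (meets i j))))
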